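{- Let $\sigma = \langle I_0,v_0\rangle\langle I_1,v_1\rangle\ldots$ be a super-dense timed trace over a set $AP$ of atomic propositions, and let $\phi,\psi$ be $\mathrm{MITL}_{0,\infty}$ formulas over $AP$ such that $\sigma$ is fine for $\phi$ and fine for $\psi$. Let $i\in\mathbb{N}$, $t,u\in I_i$, $n\in\mathbb{N}$, ${\triangleleft}\in\{<,\le\}$ and ${\triangleright}\in\{\ge,>\}$. Then: (1) if $\sigma^{(i,t)}\models \phi\,\mathbf{U}_{\triangleleft n}\,\psi$ and $u\ge t$, then $\sigma^{(i,u)}\models \phi\,\mathbf{U}_{\triangleleft n}\,\psi$; (2) if $\sigma^{(i,t)}\models \phi\,\mathbf{U}_{\triangleright n}\,\psi$ and $u\le t$, then $\sigma^{(i,u)}\models \phi\,\mathbf{U}_{\triangleright n}\,\psi$; (3) if $\sigma^{(i,t)}\models \phi\,\mathbf{R}_{\triangleleft n}\,\psi$ and $u\le t$, then $\sigma^{(i,u)}\models \phi\,\mathbf{R}_{\triangleleft n}\,\psi$; (4) if $\sigma^{(i,t)}\models \phi\,\mathbf{R}_{\triangleright n}\,\psi$ and $u\ge t$, then $\sigma^{(i,u)}\models \phi\,\mathbf{R}_{\triangleright n}\,\psi$.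
   Context: A super-dense timed trace over a set $AP$ of atomic propositions is an infinite sequence $\sigma=\langle I_0,v_0\rangle\langle I_1,v_1\rangle\ldots$ where each $v_i\subseteq AP$; each $I_i$ is either an open interval $(T_i,T_i')$ with $0\le T_i<T_i'$ or a singleton $[T_i,T_i]$, $T_i,T_i'\in\mathbb{R}_{\ge0}$; $I_0=[0,0]$; for each $i$, if $I_i=(T_i,T_i')$ then $I_{i+1}=[T_i',T_i']$, and if $I_i=[T_i,T_i]$ then $I_{i+1}=[T_i,T_i]$ or $I_{i+1}=(T_i,T'_{i+1})$; and every $t\in\mathbb{R}_{\ge0}$ lies in at least one $I_i$. The points of $\sigma$ are the pairs $(i,t)$ with $i\in\mathbb{N}$, $t\in I_i$, ordered by $(i,t)\prec(i',t')$ iff $i<i'$, or $i=i'$ and $t<t'$; $\mathrm{later}(i,t)$ denotes the set of points $(i',t')$ with $(i,t)\prec(i',t')$. $\mathrm{MITL}_{0,\infty}$ formulas over $AP$ are built from atomic propositions $p\in AP$ by $\neg$, $\wedge$, $\vee$, and the binary operators $\mathbf{U}_{\bowtie n}$ and $\mathbf{R}_{\bowtie n}$ with ${\bowtie}\in\{<,\le,\ge,>\}$, $n\in\mathbb{N}$. Satisfaction at a point: $\sigma^{(i,t)}\models p$ iff $p\in v_i$; negation, conjunction, disjunction as usual; $\sigma^{(i,t)}\models\phi\,\mathbf{U}_{\bowtie n}\,\psi$ iff there is $(i',t')\in\mathrm{later}(i,t)$ with $t'-t\bowtie n$, $\sigma^{(i',t')}\models\psi$, and $\sigma^{(i'',t'')}\models\phi$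 for all $(i'',t'')\in\mathrm{later}(i,t)$ with $(i'',t'')\prec(i',t')$; $\sigma^{(i,t)}\models\phi\,\mathbf{R}_{\bowtie n}\,\psi$ iff for every $(i',t')\in\mathrm{later}(i,t)$ with $t'-t\bowtie n$ and $\sigma^{(i',t')}\not\models\psi$ there exists $(i'',t'')\in\mathrm{later}(i,t)$ with $(i'',t'')\prec(i',t')$ and $\sigma^{(i'',t'')}\models\phi$. A trace $\sigma$ is fine for a formula $\phi$ if for every subformula $\chi$ of $\phi$ (including $\phi$), every $i$ and all $t,t'\in I_i$: $\sigma^{(i,t)}\models\chi$ iff $\sigma^{(i,t')}\models\chi$. -}

module Defs where

open import Level using (0ℓ)
open import Data.Nat as ℕ using (ℕ; zero; suc)
open import Data.Product using (Σ; _×_; _,_)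
open import Data.Sum using (_⊎_)
open import Relation.Nullary using (¬_)
open import Relation.Binary.PropositionalEquality using (_≡_)
open import Relation.Binary.Structures using (IsStrictTotalOrder)
open import Algebra.Structures using (IsCommutativeRing)

-- Every model of these axioms
-- is (classically) isomorphic to ℝ; the theorem is stated for every
-- such model.

record RealField : Set₁ where
  infixl 6 _+_
  infixl 7 _*_
  infix 4 _<_
  field
    ℝ    : Set
    0ℝ 1ℝ : ℝ
    _+_ _*_ : ℝ → ℝ → ℝ
    -_   : ℝ → ℝ
    _<_  : ℝ → ℝ → Set
    isCommutativeRing : IsCommutativeRing _≡_ _+_ _*_ -_ 0ℝ 1ℝ
    0≢1  : ¬ (0ℝ ≡ 1ℝ)
    inv  : (x : ℝ) → ¬ (x ≡ 0ℝ) → ℝ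
    inv-r : (x : ℝ) (p : ¬ (x ≡ 0ℝ)) → x * inv x p ≡ 1ℝ
    isStrictTotalOrder : IsStrictTotalOrder _≡_ _<_
    +-mono-< : ∀ {x y} z → x < y → x + z < y + z
    *-pos    : ∀ {x y} → 0ℝ < x → 0ℝ < y → 0ℝ < x * y

  infix 4 _≤_
  _≤_ : ℝ → ℝ → Set
  x ≤ y = x < y ⊎ x ≡ y

  infixl 6 _-_
  _-_ : ℝ → ℝ → ℝ
  x - y = x + (- y)

  IsUpperBound : (ℝ → Set) → ℝ → Set
  IsUpperBound S b = ∀ x → S x → x ≤ b

  IsLUB : (ℝ → Set) → ℝ → Set
  IsLUB S s = IsUpperBound S s × (∀ b → IsUpperBound S b → s ≤ b)

  field
    complete : (S : ℝ → Set) → Σ ℝ S → Σ ℝ (IsUpperBound S) → Σ ℝ (IsLUB S)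

  fromℕ : ℕ → ℝ
  fromℕ zero    = 0ℝ
  fromℕ (suc n) = 1ℝ + fromℕ n

module Semantics (Rl : RealField) (AP : Set) where
  open RealField Rl public

  data Interval : Set where
    opn  : ℝ → ℝ → Interval
    sing : ℝ → Interval

  infix 4 _∈I_
  _∈I_ : ℝ → Interval → Set
  t ∈I opn T T' = T < t × t < T'
  t ∈I sing T   = t ≡ T

  ValidInterval : Interval → Set
  ValidInterval (opn T T') = 0ℝ ≤ T × T < T'
  ValidInterval (sing T)   = 0ℝ ≤ T

  Step : Interval → Interval → Set
  Step (opn T T') J = J ≡ sing T'
  Step (sing T)   J = J ≡ sing T ⊎ Σ ℝ (λ T'' → J ≡ opn T T'')

  record Trace : Set₁ where
    field
      I     : ℕ → Interval
      v     : ℕ → AP → Set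
      valid : ∀ i → ValidInterval (I i)
      I₀    : I 0 ≡ sing 0ℝ
      step  : ∀ i → Step (I i) (I (suc i))
      cover : ∀ t → 0ℝ ≤ t → Σ ℕ (λ i → t ∈I I i)

  data Cmp : Set where
    lt le ge gt : Cmp

  cmp : Cmp → ℝ → ℝ → Set
  cmp lt x y = x < y
  cmp le x y = x ≤ y
  cmp ge x y = y ≤ x
  cmp gt x y = y < x

  infixr 5 _∨ᶠ_
  infixr 6 _∧ᶠ_
  data Formula : Set where
    atom : AP → Formula
    ¬ᶠ_  : Formula → Formula
    _∧ᶠ_ _∨ᶠ_ : Formula → Formula → Formula
    _U[_,_]_ : Formula → Cmp → ℕ → Formula → Formula
    _R[_,_]_ : Formula → Cmp → ℕ → Formula → Formula

  data _⊑_ : Formula → Formula → Set where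
    ⊑-refl : ∀ {φ} → φ ⊑ φ
    ⊑-¬    : ∀ {χ φ} → χ ⊑ φ → χ ⊑ (¬ᶠ φ)
    ⊑-∧ˡ   : ∀ {χ φ ψ} → χ ⊑ φ → χ ⊑ (φ ∧ᶠ ψ)
    ⊑-∧ʳ   : ∀ {χ φ ψ} → χ ⊑ ψ → χ ⊑ (φ ∧ᶠ ψ)
    ⊑-∨ˡ   : ∀ {χ φ ψ} → χ ⊑ φ → χ ⊑ (φ ∨ᶠ ψ)
    ⊑-∨ʳ   : ∀ {χ φ ψ} → χ ⊑ ψ → χ ⊑ (φ ∨ᶠ ψ)
    ⊑-Uˡ   : ∀ {χ φ ψ c n} → χ ⊑ φ → χ ⊑ (φ U[ c , n ] ψ)
    ⊑-Uʳ   : ∀ {χ φ ψ c n} → χ ⊑ ψ → χ ⊑ (φ U[ c , n ] ψ)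
    ⊑-Rˡ   : ∀ {χ φ ψ c n} → χ ⊑ φ → χ ⊑ (φ R[ c , n ] ψ)
    ⊑-Rʳ   : ∀ {χ φ ψ c n} → χ ⊑ ψ → χ ⊑ (φ R[ c , n ] ψ)

  module _ (σ : Trace) where
    open Trace σ

    Prec : ℕ → ℝ → ℕ → ℝ → Set
    Prec i t i' t' = i ℕ.< i' ⊎ (i ≡ i' × t < t')

    Later : ℕ → ℝ → ℕ → ℝ → Set
    Later i t i' t' = t' ∈I I i' × Prec i t i' t'

    Sat : ℕ → ℝ → Formula → Set
    Sat i t (atom p)  = v i p
    Sat i t (¬ᶠ φ)    = ¬ Sat i t φ
    Sat i t (φ ∧ᶠ ψ)  = Sat i t φ × Sat i t ψ
    Sat i t (φ ∨ᶠ ψ)  = Sat i t φ ⊎ Sat i t ψ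
    Sat i t (φ U[ c , n ] ψ) =
      Σ ℕ λ i' → Σ ℝ λ t' →
        Later i t i' t' × cmp c (t' - t) (fromℕ n) × Sat i' t' ψ ×
        (∀ i'' t'' → Later i t i'' t'' → Prec i'' t'' i' t' → Sat i'' t'' φ)
    Sat i t (φ R[ c , n ] ψ) =
      ∀ i' t' → Later i t i' t' → cmp c (t' - t) (fromℕ n) → ¬ Sat i' t' ψ →
        Σ ℕ λ i'' → Σ ℝ λ t'' →
          Later i t i'' t'' × Prec i'' t'' i' t' × Sat i'' t'' φ

    Fine : Formula → Set
    Fine φ = ∀ χ → χ ⊑ φ → ∀ i t t' → t ∈I I i → t' ∈I I i →
               (Sat i t χ → Sat i t' χ) × (Sat i t' χ → Sat i t χ)

-- By fineness, φ and ψ each hold either everywhere or nowhere on I i. Moving the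
-- evaluation point from t to u therefore only matters through the points of I i
-- between t and u; if the relevant witness (a ψ-point for U, a ¬ψ-point for R)
-- falls there, ψ resp. ¬ψ holds on all of I i, which is then an open interval, and
-- the witness can be replaced by a point of I i just above max(t, u), close enough
-- that the upper time bound still holds. The φ-obligations on the points of I i are
-- discharged likewise from any single point of I i strictly between the endpoints.

module Submission where

open import Defs
open import Data.Nat using (ℕ)
import Data.Nat.Properties as ℕ
open import Data.Product using (Σ; _×_; _,_; proj₁)
open import Data.Sum using (_⊎_; inj₁; inj₂)
open import Data.Empty using (⊥-elim)
open import Relation.Binary.PropositionalEquality
  using (_≡_; refl; sym; trans; cong; cong₂; subst₂; isEquivalence; module ≡-Reasoning)
open import Relation.Binary.Structures using (IsStrictTotalOrder)
open import Relation.Binary.Definitions using (tri<; tri≈; tri>)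
import Relation.Binary.Construct.StrictToNonStrict as NonStrict
open import Algebra.Bundles using (CommutativeRing)
import Algebra.Properties.Ring as RingProperties
import Algebra.Properties.Group as GroupProperties

module OrderedFieldProperties (Rl : RealField) where
  open RealField Rl
  open IsStrictTotalOrder isStrictTotalOrder
    using (compare; irrefl; asym; <-resp-≈; <-respˡ-≈; <-respʳ-≈)
    renaming (trans to <-trans)

  commutativeRing : CommutativeRing _ _
  commutativeRing = record { isCommutativeRing = isCommutativeRing }

  open CommutativeRing commutativeRing
    using ( +-comm; +-assoc; +-identityˡ; -‿inverseˡ; -‿inverseʳ
          ; *-identityˡ; *-identityʳ; distribˡ; distribʳ; zeroʳ; +-group )
  open RingProperties (CommutativeRing.ring commutativeRing) using (-1*x≈-x; -‿distribʳ-*)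
  open GroupProperties +-group using (⁻¹-involutive; //-rightDividesˡ; //-rightDividesʳ)

  ≤-trans : ∀ {a b c} → a ≤ b → b ≤ c → a ≤ c
  ≤-trans = NonStrict.trans _≡_ _<_ isEquivalence <-resp-≈ <-trans

  <-≤-trans : ∀ {a b c} → a < b → b ≤ c → a < c
  <-≤-trans = NonStrict.<-≤-trans _≡_ _<_ <-trans <-respʳ-≈

  ≤-<-trans : ∀ {a b c} → a ≤ b → b < c → a < c
  ≤-<-trans = NonStrict.≤-<-trans _≡_ _<_ sym <-trans <-respˡ-≈

  x<y⇒0<y-x : ∀ {x y} → x < y → 0ℝ < y - x
  x<y⇒0<y-x {x} p = subst₂ _<_ (-‿inverseʳ x) refl (+-mono-< (- x) p)

  x<0⇒0<-x : ∀ {x} → x < 0ℝ → 0ℝ < - x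
  x<0⇒0<-x {x} p = subst₂ _<_ (-‿inverseʳ x) (+-identityˡ (- x)) (+-mono-< (- x) p)

  0<-x⇒x<0 : ∀ {x} → 0ℝ < - x → x < 0ℝ
  0<-x⇒x<0 {x} p = subst₂ _<_ (+-identityˡ x) (-‿inverseˡ x) (+-mono-< x p)

  +-monoˡ-≤ : ∀ {x y} z → x ≤ y → x + z ≤ y + z
  +-monoˡ-≤ z (inj₁ x<y) = inj₁ (+-mono-< z x<y)
  +-monoˡ-≤ z (inj₂ refl) = inj₂ refl

  x-y≤x-z : ∀ {y z} x → z ≤ y → x - y ≤ x - z
  x-y≤x-z {y} {z} x z≤y = subst₂ _≤_ lhs rhs (+-monoˡ-≤ (x - y - z) z≤y)
    where
    open ≡-Reasoning
    lhs : z + (x - y - z) ≡ x - y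
    lhs = trans (+-comm z (x - y - z)) (//-rightDividesˡ z (x - y))
    rhs : y + (x - y - z) ≡ x - z
    rhs = begin
      y + (x - y - z)   ≡⟨ sym (+-assoc y (x - y) (- z)) ⟩
      y + (x - y) - z   ≡⟨ cong (_- z) (+-comm y (x - y)) ⟩
      x - y + y - z     ≡⟨ cong (_- z) (//-rightDividesˡ y x) ⟩
      x - z             ∎

  0<x*y⇒0<y : ∀ {x y} → 0ℝ < x → 0ℝ < x * y → 0ℝ < y
  0<x*y⇒0<y {x} {y} 0<x 0<xy with compare 0ℝ y
  ... | tri< 0<y _ _ = 0<y
  ... | tri≈ _ refl _ = ⊥-elim (irrefl (sym (zeroʳ x)) 0<xy)
  ... | tri> _ _ y<0 = ⊥-elim (asym 0<xy (0<-x⇒x<0 0<-[x*y]))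
    where
    0<-[x*y] : 0ℝ < - (x * y)
    0<-[x*y] = subst₂ _<_ refl (sym (-‿distribʳ-* x y)) (*-pos 0<x (x<0⇒0<-x y<0))

  0<1 : 0ℝ < 1ℝ
  0<1 with compare 0ℝ 1ℝ
  ... | tri< 0<1 _ _ = 0<1
  ... | tri≈ _ 0≡1 _ = ⊥-elim (0≢1 0≡1)
  ... | tri> _ _ 1<0 = ⊥-elim (asym 1<0 (subst₂ _<_ refl -1*-1≡1 (*-pos 0<-1 0<-1)))
    where
    0<-1 = x<0⇒0<-x 1<0
    -1*-1≡1 : - 1ℝ * - 1ℝ ≡ 1ℝ
    -1*-1≡1 = trans (-1*x≈-x (- 1ℝ)) (⁻¹-involutive 1ℝ)

  0<x+y : ∀ {x y} → 0ℝ < x → 0ℝ < y → 0ℝ < x + y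
  0<x+y {x} {y} 0<x 0<y = <-trans 0<y (subst₂ _<_ (+-identityˡ y) refl (+-mono-< y 0<x))

  private
    two : ℝ
    two = 1ℝ + 1ℝ

    0<2 : 0ℝ < two
    0<2 = 0<x+y 0<1 0<1

  ½ : ℝ
  ½ = inv two (λ 2≡0 → irrefl (sym 2≡0) 0<2)

  ½+½≡1 : ½ + ½ ≡ 1ℝ
  ½+½≡1 = begin
    ½ + ½             ≡⟨ cong₂ _+_ (sym (*-identityˡ ½)) (sym (*-identityˡ ½)) ⟩
    1ℝ * ½ + 1ℝ * ½   ≡⟨ sym (distribʳ ½ 1ℝ 1ℝ) ⟩
    two * ½           ≡⟨ inv-r two _ ⟩
    1ℝ                ∎
    where open ≡-Reasoning

  0<½ : 0ℝ < ½
  0<½ = 0<x*y⇒0<y 0<2 (subst₂ _<_ refl (sym (inv-r two _)) 0<1)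

  x*½<x : ∀ {x} → 0ℝ < x → x * ½ < x
  x*½<x {x} 0<x = subst₂ _<_ (+-identityˡ (x * ½)) x*½+x*½≡x (+-mono-< (x * ½) (*-pos 0<x 0<½))
    where
    x*½+x*½≡x : x * ½ + x * ½ ≡ x
    x*½+x*½≡x = trans (sym (distribˡ x ½ ½)) (trans (cong (x *_) ½+½≡1) (*-identityʳ x))

  positive-lower-bound : ∀ {x y} → 0ℝ < x → 0ℝ < y →
                         Σ ℝ λ e → 0ℝ < e × e ≤ x × e ≤ y
  positive-lower-bound {x} {y} 0<x 0<y with compare x y
  ... | tri< x<y _ _ = x , 0<x , inj₂ refl , inj₁ x<y
  ... | tri≈ _ x≡y _ = x , 0<x , inj₂ refl , inj₂ x≡y
  ... | tri> _ _ y<x = y , 0<y , inj₁ y<x , inj₂ refl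

  ∃-between-near : ∀ {a b d} → a < b → 0ℝ < d → Σ ℝ λ s → a < s × s < b × s - a < d
  ∃-between-near {a} {b} a<b 0<d with positive-lower-bound (x<y⇒0<y-x a<b) 0<d
  ... | e , 0<e , e≤b-a , e≤d =
    e * ½ + a ,
    subst₂ _<_ (+-identityˡ a) refl (+-mono-< a (*-pos 0<e 0<½)) ,
    <-≤-trans (+-mono-< a (x*½<x 0<e))
              (subst₂ _≤_ refl (//-rightDividesˡ a b) (+-monoˡ-≤ a e≤b-a)) ,
    <-≤-trans (subst₂ _<_ (sym (//-rightDividesʳ a (e * ½))) refl (x*½<x 0<e)) e≤d

  ∃-between : ∀ {a b} → a < b → Σ ℝ λ s → a < s × s < b
  ∃-between a<b with ∃-between-near a<b 0<1
  ... | s , a<s , s<b , _ = s , a<s , s<b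

module TimedTraceProperties (Rl : RealField) (AP : Set) where
  open Semantics Rl AP
  open OrderedFieldProperties Rl
  open IsStrictTotalOrder isStrictTotalOrder using (compare; irrefl) renaming (trans to <-trans)

  ∈I-convex : ∀ {J a b s} → a ∈I J → b ∈I J → a < s → s < b → s ∈I J
  ∈I-convex {opn T T'} (T<a , _) (_ , b<T') a<s s<b = <-trans T<a a<s , <-trans s<b b<T'
  ∈I-convex {sing T} refl refl a<s s<b = ⊥-elim (irrefl refl (<-trans a<s s<b))

  ∈I-near-above : ∀ {J a b d} → a ∈I J → b ∈I J → a < b → 0ℝ < d →
                  Σ ℝ λ s → s ∈I J × b < s × s - b < d
  ∈I-near-above {opn T T'} (T<a , _) (_ , b<T') a<b 0<d with ∃-between-near b<T' 0<d
  ... | s , b<s , s<T' , s-b<d = s , (<-trans T<a (<-trans a<b b<s) , s<T') , b<s , s-b<d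
  ∈I-near-above {sing T} refl refl a<b _ = ⊥-elim (irrefl refl a<b)

  UpperBoundCmp LowerBoundCmp : Cmp → Set
  UpperBoundCmp c = c ≡ lt ⊎ c ≡ le
  LowerBoundCmp c = c ≡ ge ⊎ c ≡ gt

  cmp-upper : ∀ {c x y N} → UpperBoundCmp c → x ≤ y → cmp c y N → cmp c x N
  cmp-upper (inj₁ refl) = ≤-<-trans
  cmp-upper (inj₂ refl) = ≤-trans

  cmp-lower : ∀ {c x y N} → LowerBoundCmp c → x ≤ y → cmp c x N → cmp c y N
  cmp-lower (inj₁ refl) x≤y N≤x = ≤-trans N≤x x≤y
  cmp-lower (inj₂ refl) x≤y N<x = <-≤-trans N<x x≤y

  module _ (σ : Trace) where
    open Trace σ

    Later-antitone : ∀ {i t u j s} → t ≤ u → Later σ i u j s → Later σ i t j s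
    Later-antitone t≤u (s∈ , inj₁ i<j) = s∈ , inj₁ i<j
    Later-antitone t≤u (s∈ , inj₂ (refl , u<s)) = s∈ , inj₂ (refl , ≤-<-trans t≤u u<s)

    Later-split : ∀ {i t j s} → Later σ i t j s → ∀ u →
                  Later σ i u j s ⊎ (j ≡ i × t < s × s ≤ u)
    Later-split (s∈ , inj₁ i<j) u = inj₁ (s∈ , inj₁ i<j)
    Later-split {s = s} (s∈ , inj₂ (refl , t<s)) u with compare u s
    ... | tri< u<s _ _ = inj₁ (s∈ , inj₂ (refl , u<s))
    ... | tri≈ _ u≡s _ = inj₂ (refl , t<s , inj₂ (sym u≡s))
    ... | tri> _ _ s<u = inj₂ (refl , t<s , inj₁ s<u)

    Prec-sandwich : ∀ {i a j r s} → Prec σ i a j r → Prec σ j r i s → j ≡ i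
    Prec-sandwich (inj₁ i<j) (inj₁ j<i) = ⊥-elim (ℕ.<-asym i<j j<i)
    Prec-sandwich (inj₁ _) (inj₂ (j≡i , _)) = j≡i
    Prec-sandwich (inj₂ (i≡j , _)) _ = sym i≡j

    Fine-transfer : ∀ {χ j a b} → Fine σ χ → a ∈I I j → b ∈I I j →
                    Sat σ j a χ → Sat σ j b χ
    Fine-transfer {χ} {j} {a} {b} F a∈ b∈ = proj₁ (F χ ⊑-refl j a b a∈ b∈)

    Fine-into-sandwich : ∀ {χ i a c j r s} → Fine σ χ → c ∈I I i → Sat σ i c χ →
                         Later σ i a j r → Prec σ j r i s → Sat σ j r χ
    Fine-into-sandwich F c∈ χc (r∈ , p) q with Prec-sandwich p q
    ... | refl = Fine-transfer F c∈ r∈ χc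

    Fine-out-of-sandwich : ∀ {χ i a c j r s} → Fine σ χ → c ∈I I i → Later σ i a j r →
                           Prec σ j r i s → Sat σ j r χ → Sat σ i c χ
    Fine-out-of-sandwich F c∈ (r∈ , p) q χr with Prec-sandwich p q
    ... | refl = Fine-transfer F r∈ c∈ χr

    point-between-same : ∀ {i b t'} → b ∈I I i → t' ∈I I i → b < t' →
                         Σ ℝ λ m → Later σ i b i m × Prec σ i m i t'
    point-between-same b∈ t'∈ b<t' with ∃-between b<t'
    ... | m , b<m , m<t' =
      m , (∈I-convex b∈ t'∈ b<m m<t' , inj₂ (refl , b<m)) , inj₂ (refl , m<t')

    point-between : ∀ {i a b i' t'} → a ∈I I i → b ∈I I i → a < b → Later σ i b i' t' →
                    Σ ℝ λ m → Later σ i b i m × Prec σ i m i' t'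
    point-between a∈ b∈ a<b (_ , inj₁ i<i') with ∈I-near-above a∈ b∈ a<b 0<1
    ... | m , m∈ , b<m , _ = m , (m∈ , inj₂ (refl , b<m)) , inj₁ i<i'
    point-between a∈ b∈ a<b (t'∈ , inj₂ (refl , b<t')) = point-between-same b∈ t'∈ b<t'

    module _ {φ ψ : Formula} {c : Cmp} {n i : ℕ} {t u : ℝ}
             (t∈ : t ∈I I i) (u∈ : u ∈I I i) where

      until-forward : Fine σ φ → Fine σ ψ → UpperBoundCmp c →
                      Sat σ i t (φ U[ c , n ] ψ) → t ≤ u → Sat σ i u (φ U[ c , n ] ψ)
      until-forward Fφ Fψ c◁ (i' , t' , later , t'-t◁n , ψt' , φ-before) t≤u
          with Later-split later u
      ... | inj₁ later-u =
        i' , t' , later-u , cmp-upper c◁ (x-y≤x-z t' t≤u) t'-t◁n , ψt' ,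
        λ j r l q → φ-before j r (Later-antitone t≤u l) q
      ... | inj₂ (refl , t<t' , t'≤u)
          with ∈I-near-above t∈ u∈ (<-≤-trans t<t' t'≤u) (x<y⇒0<y-x t<t')
             | point-between-same t∈ (proj₁ later) t<t'
      ...   | s , s∈ , u<s , s-u<t'-t | m , later-m , m-before =
        i , s , (s∈ , inj₂ (refl , u<s)) , cmp-upper c◁ (inj₁ s-u<t'-t) t'-t◁n ,
        Fine-transfer Fψ (proj₁ later) s∈ ψt' ,
        λ j r l q → Fine-into-sandwich Fφ (proj₁ later-m) (φ-before i m later-m m-before) l q

      until-backward : Fine σ φ → LowerBoundCmp c →
                       Sat σ i t (φ U[ c , n ] ψ) → u ≤ t → Sat σ i u (φ U[ c , n ] ψ)
      until-backward Fφ c▷ (i' , t' , later , t'-t▷n , ψt' , φ-before) u≤t =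
        i' , t' , Later-antitone u≤t later , cmp-lower c▷ (x-y≤x-z t' u≤t) t'-t▷n , ψt' ,
        φ-before-u
        where
        φ-before-u : ∀ j r → Later σ i u j r → Prec σ j r i' t' → Sat σ j r φ
        φ-before-u j r l q with Later-split l t
        ... | inj₁ l-t = φ-before j r l-t q
        ... | inj₂ (refl , u<r , r≤t) with point-between u∈ t∈ (<-≤-trans u<r r≤t) later
        ...   | m , later-m , m-before =
          Fine-transfer Fφ (proj₁ later-m) (proj₁ l) (φ-before i m later-m m-before)

      release-backward : Fine σ φ → Fine σ ψ → UpperBoundCmp c →
                         Sat σ i t (φ R[ c , n ] ψ) → u ≤ t → Sat σ i u (φ R[ c , n ] ψ)
      release-backward Fφ Fψ c◁ H u≤t i' t' later t'-u◁n ¬ψt' with Later-split later t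
      ... | inj₁ later-t =
        let j , r , l , q , φr = H i' t' later-t (cmp-upper c◁ (x-y≤x-z t' u≤t) t'-u◁n) ¬ψt'
        in j , r , Later-antitone u≤t l , q , φr
      ... | inj₂ (refl , u<t' , t'≤t)
          with ∈I-near-above u∈ t∈ (<-≤-trans u<t' t'≤t) (x<y⇒0<y-x u<t')
      ...   | s , s∈ , t<s , s-t<t'-u
          with H i s (s∈ , inj₂ (refl , t<s)) (cmp-upper c◁ (inj₁ s-t<t'-u) t'-u◁n)
                 (λ ψs → ¬ψt' (Fine-transfer Fψ s∈ (proj₁ later) ψs))
             | point-between-same u∈ (proj₁ later) u<t'
      ...     | j , r , l , q , φr | m , later-m , m-before =
        i , m , later-m , m-before , Fine-out-of-sandwich Fφ (proj₁ later-m) l q φr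

      release-forward : Fine σ φ → LowerBoundCmp c →
                        Sat σ i t (φ R[ c , n ] ψ) → t ≤ u → Sat σ i u (φ R[ c , n ] ψ)
      release-forward Fφ c▷ H t≤u i' t' later t'-u▷n ¬ψt'
          with H i' t' (Later-antitone t≤u later) (cmp-lower c▷ (x-y≤x-z t' t≤u) t'-u▷n) ¬ψt'
      ... | j , r , l , q , φr with Later-split l u
      ...   | inj₁ l-u = j , r , l-u , q , φr
      ...   | inj₂ (refl , t<r , r≤u) with point-between t∈ u∈ (<-≤-trans t<r r≤u) later
      ...     | m , later-m , m-before =
        i , m , later-m , m-before , Fine-transfer Fφ (proj₁ l) (proj₁ later-m) φr

lemma1 : (Rl : RealField) (AP : Set) → let open Semantics Rl AP in
    (σ : Trace) (φ ψ : Formula) → Fine σ φ → Fine σ ψ →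
    ∀ (i : ℕ) (t u : ℝ) (n : ℕ) → t ∈I Trace.I σ i → u ∈I Trace.I σ i →
    (∀ (c : Cmp) → c ≡ lt ⊎ c ≡ le →
    Sat σ i t (φ U[ c , n ] ψ) → t ≤ u → Sat σ i u (φ U[ c , n ] ψ))
    × (∀ (c : Cmp) → c ≡ ge ⊎ c ≡ gt →
    Sat σ i t (φ U[ c , n ] ψ) → u ≤ t → Sat σ i u (φ U[ c , n ] ψ))
    × (∀ (c : Cmp) → c ≡ lt ⊎ c ≡ le →
    Sat σ i t (φ R[ c , n ] ψ) → u ≤ t → Sat σ i u (φ R[ c , n ] ψ))
    × (∀ (c : Cmp) → c ≡ ge ⊎ c ≡ gt →
    Sat σ i t (φ R[ c , n ] ψ) → t ≤ u → Sat σ i u (φ R[ c , n ] ψ))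
lemma1 Rl AP σ φ ψ Fφ Fψ i t u n t∈ u∈ =
  (λ c → until-forward σ {n = n} t∈ u∈ Fφ Fψ) ,
  (λ c → until-backward σ {ψ = ψ} {n = n} t∈ u∈ Fφ) ,
  (λ c → release-backward σ {n = n} t∈ u∈ Fφ Fψ) ,
  (λ c → release-forward σ {ψ = ψ} {n = n} t∈ u∈ Fφ)
  where open TimedTraceProperties Rl AP
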